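{- Let $T$ be a semi-complete digraph and $k$ an integer. If $T$ contains a $(k+1,k)$-matching tangle, then $\mathbf{pw}(T)>k$.
   Context: All digraphs are simple. A digraph $T$ is semi-complete if for every two distinct vertices $v,w$ at least one of the arcs $(v,w)$, $(w,v)$ is present. $d^+(v)$ is the outdegree of $v$. A $(k,\ell)$-matching tangle is a pair of disjoint sets $X,Y\subseteq V(T)$ with $|X|=|Y|=k$ such that there is a bijection $f:X\to Y$ with $(v,f(v))\in E(T)$ for all $v\in X$, and $d^+(w)>d^+(v)+\ell$ for all $v\in X$, $w\in Y$. A path decomposition of a digraph $G=(V,E)$ is a sequence $(W_1,\dots,W_r)$ of subsets of $V$ such that (i) $\bigcup_i W_i=V$; (ii) $W_i\cap W_k\subseteq W_j$ for $1\le i<j<k\le r$; (iii) for every arc $(u,v)\in E$, either $u,v\in W_i$ for some $i$, or $u\in W_i$, $v\in W_j$ for some $i>j$. Its width is $\max_i(|W_i|-1)$ and $\mathbf{pw}(G)$ is the minimum width of a path decomposition. -}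

module Defs where

open import Data.Nat using (ℕ; suc; _+_; _<_; _≤_)
open import Data.Fin using (Fin) renaming (_<_ to _<ᶠ_)
open import Data.Fin.Subset using (Subset; _∈_; ∣_∣)
open import Data.Bool using (Bool; true; false; if_then_else_)
open import Data.List using (List; map; allFin)
open import Data.Nat.ListAction using (sum)
open import Data.Product using (Σ; ∃; _×_; ∃-syntax)
open import Data.Sum using (_⊎_)
open import Relation.Binary.PropositionalEquality using (_≡_; _≢_)
open import Relation.Nullary using (¬_)
open import Function.Definitions using (Injective)

record Digraph (n : ℕ) : Set where
  field
    arc     : Fin n → Fin n → Bool
    noLoops : ∀ v → arc v v ≡ false
open Digraph public

Arc : ∀ {n} → Digraph n → Fin n → Fin n → Set
Arc G u v = arc G u v ≡ true

SemiComplete : ∀ {n} → Digraph n → Set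
SemiComplete {n} T = ∀ (v w : Fin n) → v ≢ w → Arc T v w ⊎ Arc T w v

outdeg : ∀ {n} → Digraph n → Fin n → ℕ
outdeg {n} T v = sum (map (λ w → if arc T v w then 1 else 0) (allFin n))

-- (a , l)-matching tangle: disjoint X, Y of size a with a bijection f : X → Y,
-- (v , f v) arcs, and d⁺(w) > d⁺(v) + l for v ∈ X, w ∈ Y.
-- X = image of the injective map x, Y = image of the injective map y,
-- and f (x i) = y i.
MatchingTangle : ∀ {n} → Digraph n → ℕ → ℕ → Set
MatchingTangle {n} T a l =
  Σ (Fin a → Fin n) λ x → Σ (Fin a → Fin n) λ y →
      Injective _≡_ _≡_ x
    × Injective _≡_ _≡_ y
    × (∀ i j → x i ≢ y j)
    × (∀ i → Arc T (x i) (y i))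
    × (∀ i j → outdeg T (x i) + l < outdeg T (y j))

record PathDecomposition {n} (G : Digraph n) : Set where
  field
    r      : ℕ
    W      : Fin r → Subset n
    cover  : ∀ v → ∃[ i ] (v ∈ W i)
    interp : ∀ (i j l : Fin r) (v : Fin n) → i <ᶠ j → j <ᶠ l →
             v ∈ W i → v ∈ W l → v ∈ W j
    arcs   : ∀ u v → Arc G u v →
             (∃[ i ] (u ∈ W i × v ∈ W i))
             ⊎ (∃[ i ] ∃[ j ] (j <ᶠ i × u ∈ W i × v ∈ W j))
open PathDecomposition public

HasWidthAtMost : ∀ {n} {G : Digraph n} → PathDecomposition G → ℕ → Set
HasWidthAtMost D k = ∀ i → ∣ W D i ∣ ≤ suc k

PathwidthGreaterThan : ∀ {n} → Digraph n → ℕ → Set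
PathwidthGreaterThan G k = ¬ (Σ (PathDecomposition G) λ D → HasWidthAtMost D k)

module Submission where

-- Suppose T has a path decomposition D of width ≤ k and a
-- (k+1,k)-matching tangle: arcs x i → y i (i ≤ k) with d⁺(y j) > d⁺(x i) + k.
-- Every vertex v occupies an interval [start v, end v] of bags, and an arc
-- u → v forces start v ≤ end u; so, T being semi-complete, end u < start v
-- forces the arc v → u.  Let a be the latest start of an x-vertex and b the
-- earliest end of a y-vertex.  Every bag strictly after a and at or before b
-- meets every matching arc, hence holds k+1 matching vertices and is full; so
-- no vertex starts in (a, b].  Consequently a single bag c contains y_b (the
-- y-vertex ending at b) and every vertex u with start u ≤ b and a ≤ end u.
-- Any out-neighbour of y_b outside c then ends before a = start x_a, so it is
-- an out-neighbour of x_a; counting gives d⁺(y_b) < d⁺(x_a) + |c| ≤ d⁺(x_a) + k + 1,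
-- contradicting the tangle.  The file proves, in order: counting facts on
-- finite sets, the degree comparison, extremal searches on Fin, the interval
-- structure of path decompositions, the key bag, and finally the theorem.

open import Defs
open import Data.Nat using (ℕ; suc; zero; _+_; _≤_; _<_; z≤n; s≤s; _≤?_)
open import Data.Nat.Properties
  using (≤-refl; ≤-trans; ≤-reflexive; <⇒≤; <⇒≱; ≰⇒>; ≮⇒≥; 1+n≰n; 0≢1+n; m≤n⇒m<n∨m≡n;
         +-suc; +-mono-≤; +-monoʳ-≤; m≤n⇒m≤n+o; m≤n+m; +-commutativeSemigroup; module ≤-Reasoning)
open import Algebra.Properties.CommutativeSemigroup +-commutativeSemigroup using (interchange)
open import Data.Fin using (Fin; toℕ; _≟_) renaming (zero to fz; suc to fs)
open import Data.Fin.Properties using (toℕ-injective; any?) renaming (suc-injective to fs-injective)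
open import Data.Fin.Subset using (Subset; _∈_; _∉_; ∣_∣; _-_)
open import Data.Fin.Subset.Properties using (_∈?_; drop-there; x∈p⇒∣p-x∣<∣p∣; x∈p∧x≢y⇒x∈p-y)
open import Data.Vec.Base using (_∷_; [])
open import Data.Vec.Functional using () renaming (_∷_ to _◃_)
open import Data.Bool using (Bool; true; false; if_then_else_)
open import Data.List using (tabulate)
open import Data.List.Properties using (map-tabulate)
open import Data.Nat.ListAction using (sum)
open import Data.Product using (Σ; ∃; ∃-syntax; _×_; _,_; proj₁; proj₂)
open import Data.Sum using (_⊎_; inj₁; inj₂; [_,_]′)
open import Data.Empty using (⊥; ⊥-elim)
open import Relation.Binary.PropositionalEquality using (_≡_; _≢_; refl; sym; trans; cong; subst)
open import Relation.Nullary using (¬_; Dec; yes; no)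
open import Function using (_∘_; id)
open import Function.Definitions using (Injective)

injection-into-subset : ∀ {m n} (g : Fin m → Fin n) (S : Subset n) →
                        Injective _≡_ _≡_ g → (∀ i → g i ∈ S) → m ≤ ∣ S ∣
injection-into-subset {zero}  g S g-inj g∈S = z≤n
injection-into-subset {suc m} g S g-inj g∈S = begin
  suc m                ≤⟨ s≤s (injection-into-subset (g ∘ fs) (S - g fz) tail-inj tail∈) ⟩
  suc ∣ S - g fz ∣     ≤⟨ x∈p⇒∣p-x∣<∣p∣ (g∈S fz) ⟩
  ∣ S ∣                ∎
  where
  open ≤-Reasoning
  tail-inj : Injective _≡_ _≡_ (g ∘ fs)
  tail-inj eq = fs-injective (g-inj eq)
  tail∈ : ∀ i → g (fs i) ∈ S - g fz
  tail∈ i = x∈p∧x≢y⇒x∈p-y (g∈S (fs i)) (λ eq → 0≢1+n (cong toℕ (g-inj (sym eq))))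

cons-injective : ∀ {m n} {u : Fin n} {c : Fin m → Fin n} →
                 Injective _≡_ _≡_ c → (∀ j → u ≢ c j) → Injective _≡_ _≡_ (u ◃ c)
cons-injective c-inj u∉c {fz}   {fz}   eq = refl
cons-injective c-inj u∉c {fz}   {fs j} eq = ⊥-elim (u∉c j eq)
cons-injective c-inj u∉c {fs i} {fz}   eq = ⊥-elim (u∉c i (sym eq))
cons-injective c-inj u∉c {fs i} {fs j} eq = cong fs (c-inj eq)

choice-injective : ∀ {m n} {x y c : Fin m → Fin n} →
                   Injective _≡_ _≡_ x → Injective _≡_ _≡_ y → (∀ i j → x i ≢ y j) →
                   (∀ j → c j ≡ x j ⊎ c j ≡ y j) → Injective _≡_ _≡_ c
choice-injective x-inj y-inj disj choice {i} {j} eq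
  with choice i | choice j
... | inj₁ ci | inj₁ cj = x-inj (trans (sym ci) (trans eq cj))
... | inj₁ ci | inj₂ cj = ⊥-elim (disj i j (trans (sym ci) (trans eq cj)))
... | inj₂ ci | inj₁ cj = ⊥-elim (disj j i (trans (sym cj) (trans (sym eq) ci)))
... | inj₂ ci | inj₂ cj = y-inj (trans (sym ci) (trans eq cj))

∑ : ∀ {n} → (Fin n → ℕ) → ℕ
∑ f = sum (tabulate f)

+-mono-≤-excess : ∀ {a b c d s t} → a ≤ b + s → c ≤ d + t → a + c ≤ (b + d) + (s + t)
+-mono-≤-excess {b = b} {d = d} {s} {t} p q =
  ≤-trans (+-mono-≤ p q) (≤-reflexive (interchange b s d t))

∑-≤-with-exceptions : ∀ {n} (f g : Fin n → ℕ) (S : Subset n) →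
                      (∀ u → f u ≤ g u + 1) → (∀ u → u ∉ S → f u ≤ g u) →
                      ∑ f ≤ ∑ g + ∣ S ∣
∑-≤-with-exceptions {zero}  f g []      near exact = z≤n
∑-≤-with-exceptions {suc n} f g (b ∷ S) near exact = split b (exact fz)
  where
  rest : ∑ (f ∘ fs) ≤ ∑ (g ∘ fs) + ∣ S ∣
  rest = ∑-≤-with-exceptions (f ∘ fs) (g ∘ fs) S (near ∘ fs)
                             (λ u u∉S → exact (fs u) (u∉S ∘ drop-there))
  split : ∀ b′ → (fz ∉ b′ ∷ S → f fz ≤ g fz) → ∑ f ≤ ∑ g + ∣ b′ ∷ S ∣
  split true  _        = +-mono-≤-excess {s = 1} {t = ∣ S ∣} (near fz) rest
  split false fz-exact = +-mono-≤-excess {s = 0} {t = ∣ S ∣} (m≤n⇒m≤n+o 0 (fz-exact λ ())) rest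

χ : Bool → ℕ
χ b = if b then 1 else 0

χ-mono : ∀ {a b : Bool} → (a ≡ true → b ≡ true) → χ a ≤ χ b
χ-mono {false} a⇒b = z≤n
χ-mono {true}  a⇒b rewrite a⇒b refl = ≤-refl

outdeg-∑ : ∀ {n} (T : Digraph n) v → outdeg T v ≡ ∑ (λ w → χ (arc T v w))
outdeg-∑ T v = cong sum (map-tabulate id (λ w → χ (arc T v w)))

-- If w lies in S and every out-neighbour of w outside S is also an
-- out-neighbour of v, then d⁺(w) < d⁺(v) + |S|  (w is not its own neighbour).
outdeg-<-via-subset : ∀ {n} (T : Digraph n) (v w : Fin n) (S : Subset n) → w ∈ S →
                      (∀ u → Arc T w u → u ∉ S → Arc T v u) →
                      suc (outdeg T w) ≤ outdeg T v + ∣ S ∣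
outdeg-<-via-subset {n} T v w S w∈S inherited = begin
  suc (outdeg T w)              ≡⟨ cong suc (outdeg-∑ T w) ⟩
  suc (∑ (row w))               ≤⟨ s≤s (∑-≤-with-exceptions (row w) (row v) (S - w) near exact) ⟩
  suc (∑ (row v) + ∣ S - w ∣)   ≡⟨ sym (+-suc (∑ (row v)) ∣ S - w ∣) ⟩
  ∑ (row v) + suc ∣ S - w ∣     ≤⟨ +-monoʳ-≤ (∑ (row v)) (x∈p⇒∣p-x∣<∣p∣ w∈S) ⟩
  ∑ (row v) + ∣ S ∣             ≡⟨ cong (_+ ∣ S ∣) (sym (outdeg-∑ T v)) ⟩
  outdeg T v + ∣ S ∣            ∎
  where
  open ≤-Reasoning
  row : Fin n → Fin n → ℕ
  row z u = χ (arc T z u)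
  near : ∀ u → row w u ≤ row v u + 1
  near u with arc T w u
  ... | true  = m≤n+m 1 (row v u)
  ... | false = z≤n
  no-loop : ¬ Arc T w w
  no-loop loop with () ← trans (sym (noLoops T w)) loop
  exact : ∀ u → u ∉ S - w → row w u ≤ row v u
  exact u u∉S-w with u ≟ w
  ... | yes refl = χ-mono (⊥-elim ∘ no-loop)
  ... | no u≢w   = χ-mono (λ arc → inherited u arc (λ u∈S → u∉S-w (x∈p∧x≢y⇒x∈p-y u∈S u≢w)))

least : ∀ {r} (P : Fin r → Set) → (∀ i → Dec (P i)) → ∃ P →
        Σ (Fin r) λ i → P i × (∀ j → P j → toℕ i ≤ toℕ j)
least {suc r} P P? witness with P? fz
... | yes P0 = fz , P0 , λ _ _ → z≤n
least {suc r} P P? (fz   , P0) | no ¬P0 = ⊥-elim (¬P0 P0)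
least {suc r} P P? (fs w , Pw) | no ¬P0 with least (P ∘ fs) (P? ∘ fs) (w , Pw)
... | i , Pi , i-least = fs i , Pi , λ { fz P0 → ⊥-elim (¬P0 P0) ; (fs j) Pj → s≤s (i-least j Pj) }

greatest : ∀ {r} (P : Fin r → Set) → (∀ i → Dec (P i)) → ∃ P →
           Σ (Fin r) λ i → P i × (∀ j → P j → toℕ j ≤ toℕ i)
greatest {suc r} P P? witness with any? (P? ∘ fs)
... | yes later with greatest (P ∘ fs) (P? ∘ fs) later
...   | i , Pi , i-greatest = fs i , Pi , λ { fz _ → z≤n ; (fs j) Pj → s≤s (i-greatest j Pj) }
greatest {suc r} P P? (fz   , P0) | no none = fz , P0 , λ { fz _ → z≤n ; (fs j) Pj → ⊥-elim (none (j , Pj)) }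
greatest {suc r} P P? (fs w , Pw) | no none = ⊥-elim (none (w , Pw))

argmin : ∀ {m} (h : Fin (suc m) → ℕ) → Σ (Fin (suc m)) λ j → ∀ i → h j ≤ h i
argmin {zero} h = fz , λ { fz → ≤-refl }
argmin {suc m} h with argmin (h ∘ fs)
... | j , j-min with h fz ≤? h (fs j)
...   | yes h0≤ = fz   , λ { fz → ≤-refl ; (fs i) → ≤-trans h0≤ (j-min i) }
...   | no  h0≰ = fs j , λ { fz → <⇒≤ (≰⇒> h0≰) ; (fs i) → j-min i }

argmax : ∀ {m} (h : Fin (suc m) → ℕ) → Σ (Fin (suc m)) λ j → ∀ i → h i ≤ h j
argmax {zero} h = fz , λ { fz → ≤-refl }
argmax {suc m} h with argmax (h ∘ fs)
... | j , j-max with h (fs j) ≤? h fz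
...   | yes ≤h0 = fz   , λ { fz → ≤-refl ; (fs i) → ≤-trans (j-max i) ≤h0 }
...   | no  ≰h0 = fs j , λ { fz → <⇒≤ (≰⇒> ≰h0) ; (fs i) → j-max i }

-- The bags containing a vertex v form the interval [start v, end v]
-- (condition (ii)), and an arc u → v needs a bag of v no later than one
-- of u (condition (iii)), so start v ≤ end u.
module VertexIntervals {n} {G : Digraph n} (D : PathDecomposition G) where

  private
    bags-of : Fin n → Fin (r D) → Set
    bags-of v i = v ∈ W D i

    firstBag-spec : ∀ v → Σ (Fin (r D)) λ i → v ∈ W D i × (∀ j → v ∈ W D j → toℕ i ≤ toℕ j)
    firstBag-spec v = least (bags-of v) (λ i → v ∈? W D i) (cover D v)

    lastBag-spec : ∀ v → Σ (Fin (r D)) λ i → v ∈ W D i × (∀ j → v ∈ W D j → toℕ j ≤ toℕ i)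
    lastBag-spec v = greatest (bags-of v) (λ i → v ∈? W D i) (cover D v)

  firstBag lastBag : Fin n → Fin (r D)
  firstBag v = proj₁ (firstBag-spec v)
  lastBag  v = proj₁ (lastBag-spec v)

  start end : Fin n → ℕ
  start v = toℕ (firstBag v)
  end   v = toℕ (lastBag v)

  in-firstBag : ∀ v → v ∈ W D (firstBag v)
  in-firstBag v = proj₁ (proj₂ (firstBag-spec v))

  in-lastBag : ∀ v → v ∈ W D (lastBag v)
  in-lastBag v = proj₁ (proj₂ (lastBag-spec v))

  start-least : ∀ v j → v ∈ W D j → start v ≤ toℕ j
  start-least v = proj₂ (proj₂ (firstBag-spec v))

  end-greatest : ∀ v j → v ∈ W D j → toℕ j ≤ end v
  end-greatest v = proj₂ (proj₂ (lastBag-spec v))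

  start≤end : ∀ v → start v ≤ end v
  start≤end v = start-least v (lastBag v) (in-lastBag v)

  in-interval : ∀ v j → start v ≤ toℕ j → toℕ j ≤ end v → v ∈ W D j
  in-interval v j s≤j j≤e with m≤n⇒m<n∨m≡n s≤j | m≤n⇒m<n∨m≡n j≤e
  ... | inj₂ s≡j | _        = subst (λ i → v ∈ W D i) (toℕ-injective s≡j) (in-firstBag v)
  ... | inj₁ _   | inj₂ j≡e = subst (λ i → v ∈ W D i) (toℕ-injective (sym j≡e)) (in-lastBag v)
  ... | inj₁ s<j | inj₁ j<e = interp D (firstBag v) j (lastBag v) v s<j j<e (in-firstBag v) (in-lastBag v)

  arc-start≤end : ∀ {u v} → Arc G u v → start v ≤ end u
  arc-start≤end {u} {v} uv with arcs D u v uv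
  ... | inj₁ (i , u∈i , v∈i) = ≤-trans (start-least v i v∈i) (end-greatest u i u∈i)
  ... | inj₂ (i , j , j<i , u∈i , v∈j) =
    ≤-trans (start-least v j v∈j) (≤-trans (<⇒≤ j<i) (end-greatest u i u∈i))

  separated-arc : SemiComplete G → ∀ {u v} → end u < start v → Arc G v u
  separated-arc sc {u} {v} e<s with sc u v (λ { refl → <⇒≱ e<s (start≤end u) })
  ... | inj₁ uv = ⊥-elim (<⇒≱ e<s (arc-start≤end uv))
  ... | inj₂ vu = vu

module MatchingInNarrowDecomposition
  {n} {G : Digraph n} (D : PathDecomposition G) {k : ℕ} (narrow : HasWidthAtMost D k)
  (x y : Fin (suc k) → Fin n) (x-inj : Injective _≡_ _≡_ x) (y-inj : Injective _≡_ _≡_ y)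
  (disjoint : ∀ i j → x i ≢ y j) (matched : ∀ j → Arc G (x j) (y j)) where

  open VertexIntervals D

  x-late y-early : Fin (suc k)
  x-late  = proj₁ (argmax (start ∘ x))
  y-early = proj₁ (argmin (end ∘ y))

  a b : ℕ
  a = start (x x-late)
  b = end (y y-early)

  a-latest : ∀ i → start (x i) ≤ a
  a-latest = proj₂ (argmax (start ∘ x))

  b-earliest : ∀ j → b ≤ end (y j)
  b-earliest = proj₂ (argmin (end ∘ y))

  -- A bag t with a < t ≤ b meets every matching arc: it contains x j, or
  -- else x j has already ended and y j (which starts by end (x j)) is in t.
  middle-bag-meets : ∀ t → a < toℕ t → toℕ t ≤ b →
                     ∀ j → x j ∈ W D t ⊎ (y j ∈ W D t × end (x j) < toℕ t)
  middle-bag-meets t a<t t≤b j with x j ∈? W D t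
  ... | yes xj∈t = inj₁ xj∈t
  ... | no  xj∉t = inj₂ (yj∈t , x-ended)
    where
    x-ended : end (x j) < toℕ t
    x-ended = ≰⇒> (λ t≤e → xj∉t (in-interval (x j) t (≤-trans (a-latest j) (<⇒≤ a<t)) t≤e))
    yj∈t : y j ∈ W D t
    yj∈t = in-interval (y j) t (≤-trans (arc-start≤end (matched j)) (<⇒≤ x-ended))
                                (≤-trans t≤b (b-earliest j))

  -- No vertex u starts in (a, b]: its first bag would contain u together
  -- with one endpoint of each of the k+1 matching arcs, i.e. k+2 vertices.
  no-start-in-middle : ∀ u → a < start u → start u ≤ b → ⊥
  no-start-in-middle u a<s s≤b = 1+n≰n (≤-trans too-many (narrow t))
    where
    t = firstBag u
    meets = middle-bag-meets t a<s s≤b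

    rep : Fin (suc k) → Fin n
    rep j = [ (λ _ → x j) , (λ _ → y j) ]′ (meets j)

    rep-choice : ∀ j → rep j ≡ x j ⊎ rep j ≡ y j
    rep-choice j with meets j
    ... | inj₁ _ = inj₁ refl
    ... | inj₂ _ = inj₂ refl

    rep∈t : ∀ j → rep j ∈ W D t
    rep∈t j with meets j
    ... | inj₁ xj∈t       = xj∈t
    ... | inj₂ (yj∈t , _) = yj∈t

    u≢rep : ∀ j → u ≢ rep j
    u≢rep j with meets j
    ... | inj₁ _ = λ { refl → <⇒≱ a<s (a-latest j) }
    ... | inj₂ (_ , x-ended) = λ { refl → <⇒≱ x-ended (arc-start≤end (matched j)) }

    members : Fin (suc (suc k)) → Fin n
    members = u ◃ rep

    members∈t : ∀ i → members i ∈ W D t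
    members∈t fz     = in-firstBag u
    members∈t (fs j) = rep∈t j

    too-many : suc (suc k) ≤ ∣ W D t ∣
    too-many = injection-into-subset members (W D t)
                 (cons-injective (choice-injective x-inj y-inj disjoint rep-choice) u≢rep)
                 members∈t

  -- Hence one bag c contains y-early and every vertex whose interval meets
  -- both "up to b" and "from a on": if a ≤ b take the bag a (nothing starts
  -- in (a, b]); if b < a take the bag b.
  common-bag : ∃[ c ] (y y-early ∈ W D c × ∀ u → start u ≤ b → a ≤ end u → u ∈ W D c)
  common-bag with a ≤? b
  ... | yes a≤b = firstBag (x x-late) , contains (y y-early) (start≤end (y y-early)) a≤b , contains
    where
    contains : ∀ u → start u ≤ b → a ≤ end u → u ∈ W D (firstBag (x x-late))
    contains u s≤b a≤e = in-interval u _ (≮⇒≥ (λ a<s → no-start-in-middle u a<s s≤b)) a≤e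
  ... | no  a≰b = lastBag (y y-early) , in-lastBag (y y-early) , contains
    where
    contains : ∀ u → start u ≤ b → a ≤ end u → u ∈ W D (lastBag (y y-early))
    contains u s≤b a≤e = in-interval u _ s≤b (≤-trans (<⇒≤ (≰⇒> a≰b)) a≤e)

-- With c the common bag, every out-neighbour of y-early outside c starts by
-- b and ends before a = start (x x-late), so it is an out-neighbour of
-- x x-late.  Thus d⁺(y-early) < d⁺(x-late) + |c| ≤ d⁺(x-late) + k + 1,
-- contradicting the tangle's gap d⁺(x-late) + k < d⁺(y-early).
lemma13 : ∀ {n} (T : Digraph n) (k : ℕ) → SemiComplete T →
          MatchingTangle T (suc k) k → PathwidthGreaterThan T k
lemma13 {n} T k semi (x , y , x-inj , y-inj , disjoint , matched , gap) (D , narrow) =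
  1+n≰n (begin
    suc (suc (outdeg T xa + k))  ≤⟨ s≤s (gap x-late y-early) ⟩
    suc (outdeg T yb)            ≤⟨ outdeg-<-via-subset T xa yb (W D c) yb∈c inherited ⟩
    outdeg T xa + ∣ W D c ∣      ≤⟨ +-monoʳ-≤ (outdeg T xa) (narrow c) ⟩
    outdeg T xa + suc k          ≡⟨ +-suc (outdeg T xa) k ⟩
    suc (outdeg T xa + k)        ∎)
  where
  open ≤-Reasoning hiding (start)
  open VertexIntervals D
  open MatchingInNarrowDecomposition D narrow x y x-inj y-inj disjoint matched

  xa yb : Fin n
  xa = x x-late
  yb = y y-early

  c : Fin (r D)
  c = proj₁ common-bag

  yb∈c : yb ∈ W D c
  yb∈c = proj₁ (proj₂ common-bag)

  c-covers : ∀ u → start u ≤ b → a ≤ end u → u ∈ W D c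
  c-covers = proj₂ (proj₂ common-bag)

  inherited : ∀ u → Arc T yb u → u ∉ W D c → Arc T xa u
  inherited u yb→u u∉c =
    separated-arc semi (≰⇒> (λ a≤e → u∉c (c-covers u (arc-start≤end yb→u) a≤e)))
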